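{- Let $k$ be a positive integer and $\mathbb{F}$ a field of characteristic different from $2$ in which $k\neq 0$, $k\neq 1$ and $k\neq -1$. Then for any $k$ homogeneous linear forms $\ell_1,\dots,\ell_k$ over $\mathbb{F}$ in the variables $X_1,\dots,X_{k+1}$, the polynomial $S^2_{2k+1}(X_1,\dots,X_{k+1},\ell_1,\dots,\ell_k)$ is not zero.
   Context: $S_n^2(X_1,\dots,X_n) = \sum_{1\le i<j\le n} X_iX_j$; a homogeneous linear form is $\sum_k a_kX_k$ with coefficients in $\mathbb{F}$. -}

module Defs where

open import Level using (Level; _⊔_)
open import Data.Nat using (ℕ; zero; suc) renaming (_+_ to _+ℕ_)
open import Data.Fin using (Fin; _≟_; _≤_) renaming (zero to fzero; suc to fsuc)
open import Data.Product using (∃; _×_)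
open import Relation.Nullary using (¬_; yes; no)
open import Algebra.Bundles using (CommutativeRing)
open import Data.Vec.Functional as VF using ()

IsField : ∀ {c ℓ} → CommutativeRing c ℓ → Set (c ⊔ ℓ)
IsField R = ¬ (1# ≈ 0#) × (∀ x → ¬ (x ≈ 0#) → ∃ λ y → x * y ≈ 1#)
  where open CommutativeRing R

module Poly {c ℓ} (R : CommutativeRing c ℓ) where
  open CommutativeRing R

  cast : ℕ → Carrier
  cast zero    = 0#
  cast (suc n) = 1# + cast n

  -- homogeneous linear form  Σ_a l a · X_a  in variables X_0..X_{m-1}
  LinForm : ℕ → Set c
  LinForm m = Fin m → Carrier

  var : ∀ {m} → Fin m → LinForm m
  var a b with a ≟ b
  ... | yes _ = 1#
  ... | no  _ = 0#

  -- homogeneous quadratic polynomial  Σ_{a ≤ b} q a b · X_a X_b ;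
  -- only the entries with a ≤ b are meaningful coefficients.
  QuadForm : ℕ → Set c
  QuadForm m = Fin m → Fin m → Carrier

  0Q : ∀ {m} → QuadForm m
  0Q a b = 0#

  _+Q_ : ∀ {m} → QuadForm m → QuadForm m → QuadForm m
  (p +Q q) a b = p a b + q a b

  _*L_ : ∀ {m} → LinForm m → LinForm m → QuadForm m
  (l *L l') a b with a ≟ b
  ... | yes _ = l a * l' a
  ... | no  _ = l a * l' b + l b * l' a

  sumQ : ∀ {n m} → (Fin n → QuadForm m) → QuadForm m
  sumQ {zero}  f = 0Q
  sumQ {suc n} f = f fzero +Q sumQ (λ j → f (fsuc j))

  -- S²_n(Y_0,...,Y_{n-1}) = Σ_{i<j} Y_i Y_j  (split by the smaller index i)
  S2 : ∀ {n m} → (Fin n → LinForm m) → QuadForm m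
  S2 {zero}  Y = 0Q
  S2 {suc n} Y = sumQ (λ j → Y fzero *L Y (fsuc j)) +Q S2 (λ j → Y (fsuc j))

  IsZeroQ : ∀ {m} → QuadForm m → Set ℓ
  IsZeroQ {m} q = ∀ (a b : Fin m) → a ≤ b → q a b ≈ 0#

  args : ∀ k → (Fin k → LinForm (suc k)) → Fin (suc k +ℕ k) → LinForm (suc k)
  args k ls = VF._++_ {m = suc k} {n = k} var ls

-- Write Y = (X₁, …, X_{k+1}, ℓ₁, …, ℓ_k) and s = Y₁ + ⋯ + Y_{2k+1}. If S²(Y) = 0 then s² = Σᵢ Yᵢ², and
-- comparing coefficients of X_a X_b gives s_a s_b = δ_ab + Σⱼ ℓⱼ(a) ℓⱼ(b), while s_a = 1 + Σⱼ ℓⱼ(a).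
-- So the k+1 vectors u_a = (s_a, ℓ₁(a), …, ℓ_k(a)) of F^{k+1} are orthonormal for the Minkowski form
-- ⟨x, y⟩ = x₀y₀ − Σⱼ xⱼyⱼ and satisfy ⟨u_a, 𝟙⟩ = 1, where 𝟙 is the all-ones vector and ⟨𝟙, 𝟙⟩ = 1 − k.
-- The k+2 vectors 𝟙, u₀, …, u_k of F^{k+1} satisfy a nontrivial linear relation z₀𝟙 + Σ z_{a+1} u_a = 0.
-- Pairing it with u_b gives z_{b+1} = −z₀, and pairing it with 𝟙 then gives (1 − k) z₀ = (k + 1) z₀,
-- so 2k z₀ = 0 and the relation is trivial after all.
-- Without decidable equality on F the relation only exists under double negation, which suffices here.

module Submission where

open import Defs
open import Data.Nat using (ℕ; suc)
open import Data.Fin using (Fin)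
open import Relation.Nullary using (¬_)
open import Algebra.Bundles using (CommutativeRing)

open import Level using (_⊔_)
open import Data.Nat using (zero) renaming (_+_ to _+ℕ_)
open import Data.Fin using (punchIn; _↑ˡ_; _↑ʳ_; _≟_) renaming (zero to fzero; suc to fsuc)
open import Data.Fin.Properties using (≤-refl; ≤-total; suc-injective)
open import Data.Product using (∃; _×_; _,_; proj₁; proj₂)
import Data.Product as Product
open import Data.Sum using (_⊎_; inj₁; inj₂)
import Data.Sum as Sum
open import Data.Vec.Functional using (Vector; _∷_; tail; insertAt; _++_)
open import Data.Vec.Functional.Properties using (insertAt-punchIn; insertAt-lookup; lookup-++ˡ; lookup-++ʳ)
open import Effect.Monad using (RawMonad)
open import Function using (id)
open import Relation.Binary.PropositionalEquality using (_≡_; _≢_; cong)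
  renaming (refl to ≡-refl; sym to ≡-sym)
open import Relation.Nullary using (Dec; yes; no)
open import Relation.Nullary.Decidable using (¬¬-excluded-middle)
open import Relation.Nullary.Negation using (¬¬-Monad; ¬¬-map; contradiction)
import Algebra.Properties.Ring as RingProperties
import Algebra.Properties.CommutativeSemigroup as CommutativeSemigroupProperties

module _ {c ℓ} (F : CommutativeRing c ℓ) where
  open CommutativeRing F
  open Poly F
  open RingProperties ring using (-‿distribˡ-*; +-cancelʳ; +-identityʳ-unique; x∙y⁻¹≈ε⇒x≈y)
  open CommutativeSemigroupProperties *-commutativeSemigroup using (x∙yz≈y∙xz)
  open import Algebra.Properties.Semiring.Sum semiring
    using (sum; sum-syntax; sum-cong-≋; sum-replicate-zero; ∑-distrib-+; ∑-comm; sum-remove; *-distribˡ-sum; *-distribʳ-sum)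
  open import Algebra.Solver.Ring.NaturalCoefficients.Default commutativeSemiring
    using (solve; _:=_; _:+_; _:*_; con)
  open import Relation.Binary.Reasoning.Setoid setoid

  ∑-zero : ∀ {n} {f : Vector Carrier n} → (∀ i → f i ≈ 0#) → sum f ≈ 0#
  ∑-zero {n} f≈0 = trans (sum-cong-≋ f≈0) (sum-replicate-zero n)

  ∑-const : ∀ n x → ∑[ i < n ] x ≈ cast n * x
  ∑-const zero    x = sym (zeroˡ x)
  ∑-const (suc n) x = trans (+-congˡ (∑-const n x)) (sym (trans (distribʳ x 1# (cast n)) (+-congʳ (*-identityˡ x))))

  ∑-↑ : ∀ m n (f : Vector Carrier (m +ℕ n)) → sum f ≈ ∑[ i < m ] f (i ↑ˡ n) + ∑[ j < n ] f (m ↑ʳ j)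
  ∑-↑ zero    n f = sym (+-identityˡ _)
  ∑-↑ (suc m) n f = trans (+-congˡ (∑-↑ m n (tail f))) (sym (+-assoc _ _ _))

  ∑-++ : ∀ {a} {A : Set a} {m n} (xs : Vector A m) (ys : Vector A n) (f : A → Carrier) →
         ∑[ i < m +ℕ n ] f ((xs ++ ys) i) ≈ ∑[ i < m ] f (xs i) + ∑[ j < n ] f (ys j)
  ∑-++ {m = m} {n} xs ys f = trans (∑-↑ m n (λ i → f ((xs ++ ys) i)))
    (+-cong (sum-cong-≋ {m} λ i → reflexive (cong f (lookup-++ˡ xs ys i)))
            (sum-cong-≋ {n} λ j → reflexive (cong f (lookup-++ʳ xs ys j))))

  var-≡ : ∀ {m} {a b : Fin m} → a ≡ b → var a b ≈ 1#
  var-≡ {a = a} {b} a≡b with a ≟ b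
  ... | yes _   = refl
  ... | no  a≢b = contradiction a≡b a≢b

  var-≢ : ∀ {m} {a b : Fin m} → a ≢ b → var a b ≈ 0#
  var-≢ {a = a} {b} a≢b with a ≟ b
  ... | yes a≡b = contradiction a≡b a≢b
  ... | no  _   = refl

  var-suc : ∀ {m} (a b : Fin m) → var (fsuc a) (fsuc b) ≈ var a b
  var-suc a b = by-cases (a ≟ b)
    where
    by-cases : Dec (a ≡ b) → var (fsuc a) (fsuc b) ≈ var a b
    by-cases (yes a≡b) = trans (var-≡ (cong fsuc a≡b)) (sym (var-≡ a≡b))
    by-cases (no  a≢b) = trans (var-≢ (λ e → a≢b (suc-injective e))) (sym (var-≢ a≢b))

  ∑-var : ∀ {n} (a : Fin n) (f : Vector Carrier n) → ∑[ i < n ] (var i a * f i) ≈ f a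
  ∑-var {suc n} fzero f =
    trans (+-cong (*-identityˡ _) (∑-zero {n} λ i → zeroˡ _)) (+-identityʳ _)
  ∑-var {suc n} (fsuc a) f = begin
    0# * f fzero + sum (λ i → var (fsuc i) (fsuc a) * f (fsuc i))
      ≈⟨ +-cong (zeroˡ _) (sum-cong-≋ {n} λ i → *-congʳ (var-suc i a)) ⟩
    0# + sum (λ i → var i a * f (fsuc i))  ≈⟨ +-identityˡ _ ⟩
    sum (λ i → var i a * f (fsuc i))       ≈⟨ ∑-var a (tail f) ⟩
    f (fsuc a)                             ∎

  ∑-var-1 : ∀ {n} (a : Fin n) → ∑[ i < n ] var i a ≈ 1#
  ∑-var-1 {n} a = trans (sum-cong-≋ {n} λ i → sym (*-identityʳ _)) (∑-var a (λ _ → 1#))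

  sumForm : ∀ {N m} → (Fin N → LinForm m) → LinForm m
  sumForm Y a = sum (λ i → Y i a)

  gram : ∀ {N m} → (Fin N → LinForm m) → Fin m → Fin m → Carrier
  gram Y a b = sum (λ i → Y i a * Y i b)

  sumQ-coeff : ∀ {n m} (f : Fin n → QuadForm m) a b → sumQ f a b ≈ ∑[ j < n ] (f j a b)
  sumQ-coeff {zero}  f a b = refl
  sumQ-coeff {suc n} f a b = +-congˡ (sumQ-coeff (λ j → f (fsuc j)) a b)

  *L-offDiag : ∀ {m} (l l' : LinForm m) {a b} → a ≢ b → (l *L l') a b ≈ l a * l' b + l b * l' a
  *L-offDiag l l' {a} {b} a≢b with a ≟ b
  ... | yes a≡b = contradiction a≡b a≢b
  ... | no  _   = refl

  *L-diag : ∀ {m} (l l' : LinForm m) a → (l *L l') a a ≈ l a * l' a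
  *L-diag l l' a with a ≟ a
  ... | yes _   = refl
  ... | no  a≢a = contradiction ≡-refl a≢a

  S2-offDiag : ∀ {N m} (Y : Fin N → LinForm m) {a b} → a ≢ b →
               S2 Y a b + gram Y a b ≈ sumForm Y a * sumForm Y b
  S2-offDiag {zero}  Y a≢b = trans (+-identityˡ 0#) (sym (zeroˡ 0#))
  S2-offDiag {suc N} Y {a} {b} a≢b = begin
    (sumQ (λ j → Y fzero *L Y' j) a b + S2 Y' a b) + (A * B + gram Y' a b)
      ≈⟨ +-congʳ (+-congʳ cross) ⟩
    ((A * W + B * X) + S2 Y' a b) + (A * B + gram Y' a b)
      ≈⟨ solve 6 (λ A B X W S G → ((A :* W :+ B :* X) :+ S) :+ (A :* B :+ G)
                                   := (A :* B :+ (A :* W :+ B :* X)) :+ (S :+ G)) refl A B X W _ _ ⟩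
    (A * B + (A * W + B * X)) + (S2 Y' a b + gram Y' a b)
      ≈⟨ +-congˡ (S2-offDiag Y' a≢b) ⟩
    (A * B + (A * W + B * X)) + X * W
      ≈⟨ solve 4 (λ A B X W → (A :* B :+ (A :* W :+ B :* X)) :+ X :* W := (A :+ X) :* (B :+ W)) refl A B X W ⟩
    (A + X) * (B + W) ∎
    where
    Y' = λ j → Y (fsuc j)
    A = Y fzero a
    B = Y fzero b
    X = sumForm Y' a
    W = sumForm Y' b
    cross : sumQ (λ j → Y fzero *L Y' j) a b ≈ A * W + B * X
    cross = begin
      sumQ (λ j → Y fzero *L Y' j) a b      ≈⟨ sumQ-coeff (λ j → Y fzero *L Y' j) a b ⟩
      sum (λ j → (Y fzero *L Y' j) a b)     ≈⟨ sum-cong-≋ (λ j → *L-offDiag (Y fzero) (Y' j) a≢b) ⟩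
      sum (λ j → A * Y' j b + B * Y' j a)   ≈⟨ ∑-distrib-+ (λ j → A * Y' j b) (λ j → B * Y' j a) ⟩
      sum (λ j → A * Y' j b) + sum (λ j → B * Y' j a)
        ≈⟨ +-cong (sym (*-distribˡ-sum A (λ j → Y' j b))) (sym (*-distribˡ-sum B (λ j → Y' j a))) ⟩
      A * W + B * X                          ∎

  S2-diag : ∀ {N m} (Y : Fin N → LinForm m) a →
            (S2 Y a a + S2 Y a a) + gram Y a a ≈ sumForm Y a * sumForm Y a
  S2-diag {zero}  Y a = trans (+-identityʳ (0# + 0#)) (trans (+-identityˡ 0#) (sym (zeroˡ 0#)))
  S2-diag {suc N} Y a = begin
    ((cross + S2 Y' a a) + (cross + S2 Y' a a)) + (A * A + gram Y' a a)
      ≈⟨ +-congʳ (+-cong (+-congʳ cross≈) (+-congʳ cross≈)) ⟩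
    ((A * X + S2 Y' a a) + (A * X + S2 Y' a a)) + (A * A + gram Y' a a)
      ≈⟨ solve 4 (λ A X S G → ((A :* X :+ S) :+ (A :* X :+ S)) :+ (A :* A :+ G)
                              := (A :* A :+ (A :* X :+ A :* X)) :+ ((S :+ S) :+ G)) refl A X _ _ ⟩
    (A * A + (A * X + A * X)) + ((S2 Y' a a + S2 Y' a a) + gram Y' a a)
      ≈⟨ +-congˡ (S2-diag Y' a) ⟩
    (A * A + (A * X + A * X)) + X * X
      ≈⟨ solve 2 (λ A X → (A :* A :+ (A :* X :+ A :* X)) :+ X :* X := (A :+ X) :* (A :+ X)) refl A X ⟩
    (A + X) * (A + X) ∎
    where
    Y' = λ j → Y (fsuc j)
    A = Y fzero a
    X = sumForm Y' a
    cross = sumQ (λ j → Y fzero *L Y' j) a a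
    cross≈ : cross ≈ A * X
    cross≈ = begin
      cross                              ≈⟨ sumQ-coeff (λ j → Y fzero *L Y' j) a a ⟩
      sum (λ j → (Y fzero *L Y' j) a a)  ≈⟨ sum-cong-≋ (λ j → *L-diag (Y fzero) (Y' j) a) ⟩
      sum (λ j → A * Y' j a)             ≈⟨ *-distribˡ-sum A (λ j → Y' j a) ⟨
      A * X                              ∎

  S2≈0⇒sumForm²≈gram : ∀ {N m} (Y : Fin N → LinForm m) → IsZeroQ (S2 Y) →
                       ∀ a b → sumForm Y a * sumForm Y b ≈ gram Y a b
  S2≈0⇒sumForm²≈gram {N} Y S2≈0 a b with a ≟ b
  ... | yes ≡-refl = begin
    sumForm Y a * sumForm Y a           ≈⟨ S2-diag Y a ⟨
    (S2 Y a a + S2 Y a a) + gram Y a a  ≈⟨ +-congʳ (trans (+-cong S2aa≈0 S2aa≈0) (+-identityˡ 0#)) ⟩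
    0# + gram Y a a                     ≈⟨ +-identityˡ _ ⟩
    gram Y a a                          ∎
    where S2aa≈0 = S2≈0 a a ≤-refl
  ... | no a≢b with ≤-total a b
  ... | inj₁ a≤b = begin
    sumForm Y a * sumForm Y b  ≈⟨ S2-offDiag Y a≢b ⟨
    S2 Y a b + gram Y a b      ≈⟨ trans (+-congʳ (S2≈0 a b a≤b)) (+-identityˡ _) ⟩
    gram Y a b                 ∎
  ... | inj₂ b≤a = begin
    sumForm Y a * sumForm Y b  ≈⟨ *-comm _ _ ⟩
    sumForm Y b * sumForm Y a  ≈⟨ S2-offDiag Y (λ b≡a → a≢b (≡-sym b≡a)) ⟨
    S2 Y b a + gram Y b a      ≈⟨ trans (+-congʳ (S2≈0 b a b≤a)) (+-identityˡ _) ⟩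
    gram Y b a                 ≈⟨ sum-cong-≋ {N} (λ i → *-comm _ _) ⟩
    gram Y a b                 ∎

  dot : ∀ {n} → Vector Carrier n → Vector Carrier n → Carrier
  dot {n} w y = ∑[ r < n ] (w r * y r)

  dot-linearʳ : ∀ {m n} (w : Vector Carrier n) (z : Vector Carrier m) (V : Fin m → Vector Carrier n) →
                dot w (λ r → ∑[ i < m ] (z i * V i r)) ≈ ∑[ i < m ] (z i * dot w (V i))
  dot-linearʳ {m} {n} w z V = begin
    ∑[ r < n ] (w r * ∑[ i < m ] (z i * V i r))
      ≈⟨ sum-cong-≋ {n} (λ r → *-distribˡ-sum (w r) (λ i → z i * V i r)) ⟩
    ∑[ r < n ] ∑[ i < m ] (w r * (z i * V i r))
      ≈⟨ sum-cong-≋ {n} (λ r → sum-cong-≋ {m} (λ i → x∙yz≈y∙xz (w r) (z i) (V i r))) ⟩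
    ∑[ r < n ] ∑[ i < m ] (z i * (w r * V i r))
      ≈⟨ ∑-comm (λ r i → z i * (w r * V i r)) ⟩
    ∑[ i < m ] ∑[ r < n ] (z i * (w r * V i r))
      ≈⟨ sum-cong-≋ {m} (λ i → *-distribˡ-sum (z i) (λ r → w r * V i r)) ⟨
    ∑[ i < m ] (z i * dot w (V i)) ∎

  minkowskiDual : ∀ {n} → Vector Carrier (suc n) → Vector Carrier (suc n)
  minkowskiDual x fzero    = x fzero
  minkowskiDual x (fsuc j) = - x (fsuc j)

  ⟨_,_⟩ : ∀ {n} → Vector Carrier (suc n) → Vector Carrier (suc n) → Carrier
  ⟨ x , y ⟩ = dot (minkowskiDual x) y

  ⟨⟩-comm : ∀ {n} (x y : Vector Carrier (suc n)) → ⟨ x , y ⟩ ≈ ⟨ y , x ⟩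
  ⟨⟩-comm {n} x y = +-cong (*-comm _ _) (sum-cong-≋ {n} λ j → begin
    - x (fsuc j) * y (fsuc j)    ≈⟨ -‿distribˡ-* _ _ ⟨
    - (x (fsuc j) * y (fsuc j))  ≈⟨ -‿cong (*-comm _ _) ⟩
    - (y (fsuc j) * x (fsuc j))  ≈⟨ -‿distribˡ-* _ _ ⟩
    - y (fsuc j) * x (fsuc j)    ∎)

  ⟨⟩-+-dot : ∀ {n} (x y : Vector Carrier (suc n)) → ⟨ x , y ⟩ + dot (tail x) (tail y) ≈ x fzero * y fzero
  ⟨⟩-+-dot {n} x y = begin
    (x₀y₀ + ∑[ j < n ] (- x (fsuc j) * y (fsuc j))) + ∑[ j < n ] (x (fsuc j) * y (fsuc j))
      ≈⟨ +-assoc _ _ _ ⟩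
    x₀y₀ + (∑[ j < n ] (- x (fsuc j) * y (fsuc j)) + ∑[ j < n ] (x (fsuc j) * y (fsuc j)))
      ≈⟨ +-congˡ (∑-distrib-+ (λ j → - x (fsuc j) * y (fsuc j)) (λ j → x (fsuc j) * y (fsuc j))) ⟨
    x₀y₀ + ∑[ j < n ] (- x (fsuc j) * y (fsuc j) + x (fsuc j) * y (fsuc j))
      ≈⟨ +-congˡ (∑-zero {n} λ j → trans (+-congʳ (sym (-‿distribˡ-* _ _))) (-‿inverseˡ _)) ⟩
    x₀y₀ + 0#  ≈⟨ +-identityʳ _ ⟩
    x₀y₀       ∎
    where x₀y₀ = x fzero * y fzero

  ones : ∀ {n} → Vector Carrier n
  ones _ = 1#

  ⟨ones,ones⟩ : ∀ n → ⟨ ones {suc n} , ones ⟩ + cast n ≈ 1#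
  ⟨ones,ones⟩ n = begin
    ⟨ 𝟙 , 𝟙 ⟩ + cast n                  ≈⟨ +-congˡ (trans (∑-const n (1# * 1#)) (trans (*-congˡ (*-identityˡ 1#)) (*-identityʳ _))) ⟨
    ⟨ 𝟙 , 𝟙 ⟩ + ∑[ j < n ] (1# * 1#)    ≈⟨ trans (⟨⟩-+-dot 𝟙 𝟙) (*-identityˡ 1#) ⟩
    1#                                  ∎
    where 𝟙 = ones {suc n}

  Nontrivial : ∀ {m} → Vector Carrier m → Set ℓ
  Nontrivial z = ∃ λ i → ¬ z i ≈ 0#

  LinearlyDependent : ∀ {m n} → (Fin m → Vector Carrier n) → Set (c ⊔ ℓ)
  LinearlyDependent {m} v = ∃ λ (z : Vector Carrier m) → Nontrivial z × (∀ r → ∑[ i < m ] (z i * v i r) ≈ 0#)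

  relation⇒dot-relation : ∀ {m n} (z : Vector Carrier m) (v : Fin m → Vector Carrier n) →
                          (∀ r → ∑[ i < m ] (z i * v i r) ≈ 0#) → ∀ w → ∑[ i < m ] (z i * dot w (v i)) ≈ 0#
  relation⇒dot-relation {n = n} z v relation w =
    trans (sym (dot-linearʳ w z v)) (∑-zero {n} λ r → trans (*-congˡ (relation r)) (zeroʳ (w r)))

  ¬¬-allZero⊎nontrivial : ∀ {n} (f : Vector Carrier n) → ¬ ¬ ((∀ i → f i ≈ 0#) ⊎ Nontrivial f)
  ¬¬-allZero⊎nontrivial {zero}  f = pure (inj₁ λ ())
    where open RawMonad (¬¬-Monad {a = ℓ})
  ¬¬-allZero⊎nontrivial {suc n} f = do
      yes f₀≈0 ← ¬¬-excluded-middle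
        where no f₀≉0 → pure (inj₂ (fzero , f₀≉0))
      rest ← ¬¬-allZero⊎nontrivial (tail f)
      pure (Sum.map (λ tail≈0 → λ { fzero → f₀≈0 ; (fsuc i) → tail≈0 i }) (Product.map fsuc id) rest)
    where open RawMonad (¬¬-Monad {a = ℓ})

  record Elimination {m n} (v : Fin (suc m) → Vector Carrier (suc n)) : Set (c ⊔ ℓ) where
    field
      pivot            : Fin (suc m)
      factor           : Vector Carrier m
      remainder        : Fin m → Vector Carrier (suc n)
      remainder-head≈0 : ∀ i → remainder i fzero ≈ 0#
      decompose        : ∀ i r → v (punchIn pivot i) r ≈ remainder i r + factor i * v pivot r

  Elimination⇒dependent : ∀ {m n} {v : Fin (suc m) → Vector Carrier (suc n)} (E : Elimination v) →
                          LinearlyDependent (λ i → tail (Elimination.remainder E i)) → LinearlyDependent v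
  Elimination⇒dependent {m} {n} {v} E (z , (i₀ , zi₀≉0) , z-relation) =
    z⁺ , (punchIn pivot i₀ , z⁺≉0) , relation
    where
    open Elimination E
    β = ∑[ i < m ] (z i * factor i)
    z⁺ = insertAt z pivot (- β)

    z⁺-punchIn : ∀ i → z⁺ (punchIn pivot i) ≈ z i
    z⁺-punchIn i = reflexive (insertAt-punchIn z pivot (- β) i)

    z⁺≉0 : ¬ z⁺ (punchIn pivot i₀) ≈ 0#
    z⁺≉0 z⁺≈0 = zi₀≉0 (trans (sym (z⁺-punchIn i₀)) z⁺≈0)

    remainder-relation : ∀ r → ∑[ i < m ] (z i * remainder i r) ≈ 0#
    remainder-relation fzero    = ∑-zero {m} λ i → trans (*-congˡ (remainder-head≈0 i)) (zeroʳ _)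
    remainder-relation (fsuc r) = z-relation r

    relation : ∀ r → ∑[ j < suc m ] (z⁺ j * v j r) ≈ 0#
    relation r = begin
      ∑[ j < suc m ] (z⁺ j * v j r)
        ≈⟨ sum-remove {i = pivot} (λ j → z⁺ j * v j r) ⟩
      z⁺ pivot * p + ∑[ i < m ] (z⁺ (punchIn pivot i) * v (punchIn pivot i) r)
        ≈⟨ +-cong (*-congʳ (reflexive (insertAt-lookup z pivot (- β))))
                  (sum-cong-≋ {m} λ i → *-cong (z⁺-punchIn i) (decompose i r)) ⟩
      - β * p + ∑[ i < m ] (z i * (remainder i r + factor i * p))
        ≈⟨ +-congˡ (trans (sum-cong-≋ {m} λ i → distribˡ (z i) _ _)
                          (∑-distrib-+ (λ i → z i * remainder i r) (λ i → z i * (factor i * p)))) ⟩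
      - β * p + (∑[ i < m ] (z i * remainder i r) + ∑[ i < m ] (z i * (factor i * p)))
        ≈⟨ +-congˡ (+-cong (remainder-relation r) factored) ⟩
      - β * p + (0# + β * p)  ≈⟨ +-congˡ (+-identityˡ _) ⟩
      - β * p + β * p         ≈⟨ distribʳ p (- β) β ⟨
      (- β + β) * p           ≈⟨ trans (*-congʳ (-‿inverseˡ β)) (zeroˡ p) ⟩
      0#                      ∎
      where
      p = v pivot r
      factored : ∑[ i < m ] (z i * (factor i * p)) ≈ β * p
      factored = trans (sum-cong-≋ {m} λ i → sym (*-assoc _ _ _)) (sym (*-distribʳ-sum p (λ i → z i * factor i)))

  zeroColumnElimination : ∀ {m n} (v : Fin (suc m) → Vector Carrier (suc n)) →
                          (∀ i → v i fzero ≈ 0#) → Elimination v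
  zeroColumnElimination v column≈0 = record
    { pivot            = fzero
    ; factor           = λ _ → 0#
    ; remainder        = λ i → v (fsuc i)
    ; remainder-head≈0 = λ i → column≈0 (fsuc i)
    ; decompose        = λ i r → sym (trans (+-congˡ (zeroˡ _)) (+-identityʳ _))
    }

  module _ {k} (ls : Fin k → LinForm (suc k)) where

    column : Fin (suc k) → Vector Carrier (suc k)
    column a = sumForm (args k ls) a ∷ λ j → ls j a

    ⟨column,column⟩ : IsZeroQ (S2 (args k ls)) → ∀ a b → ⟨ column a , column b ⟩ ≈ var a b
    ⟨column,column⟩ S2≈0 a b = +-cancelʳ (gram ls a b) _ _ (begin
      ⟨ column a , column b ⟩ + gram ls a b              ≈⟨ ⟨⟩-+-dot (column a) (column b) ⟩
      sumForm Y a * sumForm Y b                          ≈⟨ S2≈0⇒sumForm²≈gram Y S2≈0 a b ⟩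
      gram Y a b                                         ≈⟨ ∑-++ var ls (λ l → l a * l b) ⟩
      ∑[ i < suc k ] (var i a * var i b) + gram ls a b  ≈⟨ +-congʳ (∑-var a (λ i → var i b)) ⟩
      var a b + gram ls a b                              ∎)
      where Y = args k ls

    ⟨column,ones⟩ : ∀ b → ⟨ column b , ones ⟩ ≈ 1#
    ⟨column,ones⟩ b = +-cancelʳ T _ _ (begin
      ⟨ column b , ones ⟩ + T                         ≈⟨ +-congˡ (sum-cong-≋ {k} λ j → *-identityʳ (ls j b)) ⟨
      ⟨ column b , ones ⟩ + ∑[ j < k ] (ls j b * 1#)  ≈⟨ ⟨⟩-+-dot (column b) ones ⟩
      sumForm Y b * 1#                                ≈⟨ *-identityʳ _ ⟩
      sumForm Y b                                     ≈⟨ ∑-++ var ls (λ l → l b) ⟩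
      ∑[ i < suc k ] var i b + T                      ≈⟨ +-congʳ (∑-var-1 b) ⟩
      1# + T                                          ∎)
      where
      Y = args k ls
      T = ∑[ j < k ] ls j b

  module _ (isField : IsField F) where

    x≉0∧x*y≈0⇒y≈0 : ∀ {x y} → ¬ x ≈ 0# → x * y ≈ 0# → y ≈ 0#
    x≉0∧x*y≈0⇒y≈0 {x} {y} x≉0 xy≈0 with proj₂ isField x x≉0
    ... | x⁻¹ , xx⁻¹≈1 = begin
      y              ≈⟨ *-identityˡ y ⟨
      1# * y         ≈⟨ *-congʳ (trans (*-comm x⁻¹ x) xx⁻¹≈1) ⟨
      x⁻¹ * x * y    ≈⟨ *-assoc x⁻¹ x y ⟩
      x⁻¹ * (x * y)  ≈⟨ *-congˡ xy≈0 ⟩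
      x⁻¹ * 0#       ≈⟨ zeroʳ x⁻¹ ⟩
      0#             ∎

    pivotElimination : ∀ {m n} (v : Fin (suc m) → Vector Carrier (suc n)) p →
                       ¬ v p fzero ≈ 0# → Elimination v
    pivotElimination v p vp≉0 with proj₂ isField (v p fzero) vp≉0
    ... | α , vpα≈1 = record
      { pivot            = p
      ; factor           = t
      ; remainder        = λ i r → v (punchIn p i) r - t i * v p r
      ; remainder-head≈0 = λ i → trans (+-congˡ (-‿cong (t-pivot i))) (-‿inverseʳ _)
      ; decompose        = λ i r → sym (trans (+-assoc _ _ _) (trans (+-congˡ (-‿inverseˡ _)) (+-identityʳ _)))
      }
      where
      t : ∀ i → Carrier
      t i = v (punchIn p i) fzero * α
      t-pivot : ∀ i → t i * v p fzero ≈ v (punchIn p i) fzero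
      t-pivot i = trans (*-assoc _ _ _) (trans (*-congˡ (trans (*-comm α _) vpα≈1)) (*-identityʳ _))

    ¬¬-elimination : ∀ {m n} (v : Fin (suc m) → Vector Carrier (suc n)) → ¬ ¬ Elimination v
    ¬¬-elimination v = ¬¬-map eliminate (¬¬-allZero⊎nontrivial (λ i → v i fzero))
      where
      eliminate : (∀ i → v i fzero ≈ 0#) ⊎ Nontrivial (λ i → v i fzero) → Elimination v
      eliminate (inj₁ column≈0)   = zeroColumnElimination v column≈0
      eliminate (inj₂ (p , vp≉0)) = pivotElimination v p vp≉0

    ¬¬-dependent : ∀ n (v : Fin (suc n) → Vector Carrier n) → ¬ ¬ LinearlyDependent v
    ¬¬-dependent zero    v = pure ((λ _ → 1#) , (fzero , proj₁ isField) , λ ())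
      where open RawMonad (¬¬-Monad {a = c ⊔ ℓ})
    ¬¬-dependent (suc n) v = do
        E ← ¬¬-elimination v
        dependent ← ¬¬-dependent n (λ i → tail (Elimination.remainder E i))
        pure (Elimination⇒dependent E dependent)
      where open RawMonad (¬¬-Monad {a = c ⊔ ℓ})

    x≉y∧x*z≈y*z⇒z≈0 : ∀ {x y z} → ¬ x ≈ y → x * z ≈ y * z → z ≈ 0#
    x≉y∧x*z≈y*z⇒z≈0 {x} {y} {z} x≉y xz≈yz = x≉0∧x*y≈0⇒y≈0 x-y≉0 (begin
      (x - y) * z      ≈⟨ distribʳ z x (- y) ⟩
      x * z + - y * z  ≈⟨ +-congˡ (-‿distribˡ-* y z) ⟨
      x * z - y * z    ≈⟨ +-congʳ xz≈yz ⟩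
      y * z - y * z    ≈⟨ -‿inverseʳ (y * z) ⟩
      0#               ∎)
      where
      x-y≉0 : ¬ x - y ≈ 0#
      x-y≉0 x-y≈0 = x≉y (x∙y⁻¹≈ε⇒x≈y x y x-y≈0)

    1+2k≈1⇒k≈0 : ¬ cast 2 ≈ 0# → ∀ k → cast (suc k) + cast k ≈ 1# → cast k ≈ 0#
    1+2k≈1⇒k≈0 2≉0 k 1+2k≈1 = x≉0∧x*y≈0⇒y≈0 2≉0 (begin
      cast 2 * cast k  ≈⟨ solve 1 (λ K → (con 1 :+ (con 1 :+ con 0)) :* K := K :+ K) refl (cast k) ⟩
      cast k + cast k  ≈⟨ +-identityʳ-unique 1# _ (trans (sym (+-assoc 1# (cast k) (cast k))) 1+2k≈1) ⟩
      0#               ∎)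

    orthonormal-independent : ∀ {m n} (u : Fin m → Vector Carrier (suc n)) →
                              (∀ a b → ⟨ u a , u b ⟩ ≈ var a b) → (∀ a → ⟨ u a , ones ⟩ ≈ 1#) →
                              ¬ cast m + cast n ≈ 1# → ¬ LinearlyDependent (ones ∷ u)
    orthonormal-independent {m} {n} u ⟨u,u⟩ ⟨u,1⟩ m+n≉1 (z , (i₀ , zi₀≉0) , relation) = zi₀≉0 (z≈0 i₀)
      where
      z₀ = z fzero
      S = ∑[ a < m ] z (fsuc a)
      E = ⟨ ones {suc n} , ones ⟩

      pairing : ∀ x → z₀ * ⟨ x , ones ⟩ + ∑[ a < m ] (z (fsuc a) * ⟨ x , u a ⟩) ≈ 0#
      pairing x = relation⇒dot-relation z (ones ∷ u) relation (minkowskiDual x)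

      z₀+z≈0 : ∀ b → z₀ + z (fsuc b) ≈ 0#
      z₀+z≈0 b = begin
        z₀ + z (fsuc b)                              ≈⟨ +-cong (*-identityʳ z₀) (∑-var b (tail z)) ⟨
        z₀ * 1# + ∑[ a < m ] (var a b * z (fsuc a))
          ≈⟨ +-cong (*-congˡ (⟨u,1⟩ b))
                    (sum-cong-≋ {m} λ a → trans (*-congˡ (trans (⟨⟩-comm (u b) (u a)) (⟨u,u⟩ a b))) (*-comm _ _)) ⟨
        z₀ * ⟨ u b , ones ⟩ + ∑[ a < m ] (z (fsuc a) * ⟨ u b , u a ⟩)  ≈⟨ pairing (u b) ⟩
        0#                                           ∎

      z₀E+S≈0 : z₀ * E + S ≈ 0#
      z₀E+S≈0 = trans (+-congˡ (sum-cong-≋ {m} λ a → trans (sym (*-identityʳ _)) (*-congˡ (sym (⟨1,u⟩ a)))))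
                      (pairing ones)
        where
        ⟨1,u⟩ : ∀ a → ⟨ ones , u a ⟩ ≈ 1#
        ⟨1,u⟩ a = trans (⟨⟩-comm ones (u a)) (⟨u,1⟩ a)

      mz₀+S≈0 : cast m * z₀ + S ≈ 0#
      mz₀+S≈0 = begin
        cast m * z₀ + S                    ≈⟨ +-congʳ (∑-const m z₀) ⟨
        ∑[ a < m ] z₀ + S                  ≈⟨ ∑-distrib-+ (λ _ → z₀) (tail z) ⟨
        ∑[ a < m ] (z₀ + z (fsuc a))       ≈⟨ ∑-zero {m} z₀+z≈0 ⟩
        0#                                 ∎

      z₀≈0 : z₀ ≈ 0#
      z₀≈0 = x≉y∧x*z≈y*z⇒z≈0 m+n≉1 (begin
        (cast m + cast n) * z₀     ≈⟨ distribʳ z₀ (cast m) (cast n) ⟩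
        cast m * z₀ + cast n * z₀  ≈⟨ +-cong (+-cancelʳ S _ _ (trans mz₀+S≈0 (sym z₀E+S≈0))) (*-comm _ _) ⟩
        z₀ * E + z₀ * cast n       ≈⟨ distribˡ z₀ E (cast n) ⟨
        z₀ * (E + cast n)          ≈⟨ *-congˡ (⟨ones,ones⟩ n) ⟩
        z₀ * 1#                    ≈⟨ *-comm z₀ 1# ⟩
        1# * z₀                    ∎)

      z≈0 : ∀ i → z i ≈ 0#
      z≈0 fzero    = z₀≈0
      z≈0 (fsuc b) = trans (sym (+-identityˡ _)) (trans (+-congʳ (sym z₀≈0)) (z₀+z≈0 b))

mainTheorem20 : ∀ {c ℓ} (F : CommutativeRing c ℓ) → IsField F →
    let open CommutativeRing F
        open Poly F
    in ¬ (cast 2 ≈ 0#) →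
       (k : ℕ) → 1 Data.Nat.≤ k →
       ¬ (cast k ≈ 0#) → ¬ (cast k ≈ 1#) → ¬ (cast k ≈ - 1#) →
       (ls : Fin k → LinForm (suc k)) →
       ¬ IsZeroQ (S2 (args k ls))
mainTheorem20 F isField 2≉0 k _ k≉0 _ _ ls S2≈0 =
  ¬¬-dependent F isField (suc k) (ones F ∷ column F ls)
    (orthonormal-independent F isField (column F ls) (⟨column,column⟩ F ls S2≈0) (⟨column,ones⟩ F ls)
      (λ 1+2k≈1 → k≉0 (1+2k≈1⇒k≈0 F isField 2≉0 k 1+2k≈1)))
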